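{- For every $k$ there is an edge-coloured directed graph $D_k$ with two vertices $u$ and $v$ such that: (I) for every set $S$ of $k$ colours there is a rainbow $u$ to $v$ path avoiding the colours in $S$; and (II) any two rainbow $u$ to $v$ paths $P_1,P_2$ have a common edge.
   Context: A directed path is rainbow if its edges have pairwise distinct colours; it avoids a set $S$ of colours if none of its edges has a colour in $S$. -}

module Defs where

open import Data.Nat using (ℕ)
open import Data.Fin using (Fin)
open import Data.Maybe using (Maybe; just; nothing; Is-just)
open import Data.List using (List; []; _∷_; _∷ʳ_; mapMaybe)
open import Data.List.Relation.Unary.All using (All)
open import Data.List.Relation.Unary.Unique.Propositional using (Unique)
open import Data.List.Membership.Propositional using (_∈_; _∉_)
open import Data.Product using (_×_; _,_; ∃-syntax; uncurry)

-- A finite edge-coloured directed graph (no parallel edges) on vertex set Fin n: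
-- col x y = just c  means there is an edge x → y of colour c (colours are natural numbers),
-- col x y = nothing means there is no edge x → y.
record ColouredDigraph : Set where
  field
    n   : ℕ
    col : Fin n → Fin n → Maybe ℕ

open ColouredDigraph public

pairs : {A : Set} → List A → List (A × A)
pairs []           = []
pairs (x ∷ [])     = []
pairs (x ∷ y ∷ xs) = (x , y) ∷ pairs (y ∷ xs)

module _ (D : ColouredDigraph) where

  V : Set
  V = Fin (n D)

  -- the vertex sequence of the u–v path with intermediate vertices `mid`
  verts : V → List V → V → List V
  verts u mid v = u ∷ (mid ∷ʳ v)

  edges : V → List V → V → List (V × V)
  edges u mid v = pairs (verts u mid v)

  colours : V → List V → V → List ℕ
  colours u mid v = mapMaybe (uncurry (col D)) (edges u mid v)

  IsPath : V → List V → V → Set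
  IsPath u mid v = Unique (verts u mid v)
                 × All (λ e → Is-just (uncurry (col D) e)) (edges u mid v)

  Rainbow : V → List V → V → Set
  Rainbow u mid v = Unique (colours u mid v)

  Avoids : List ℕ → V → List V → V → Set
  Avoids S u mid v = All (λ c → c ∉ S) (colours u mid v)

  RainbowPath : V → List V → V → Set
  RainbowPath u mid v = IsPath u mid v × Rainbow u mid v

  CommonEdge : V → List V → List V → V → Set
  CommonEdge u P₁ P₂ v = ∃[ e ] (e ∈ edges u P₁ v × e ∈ edges u P₂ v)

module Submission where

-- Construction (P = k(k+1) detour types, M = 2P+1 levels): a spine of M direct
-- edges, the one of level i coloured (direct , i), and at every level, for every
-- detour type t, a two-edge detour coloured (entry , t), (exit , t). The kinds are
-- the residues mod 3, so a colour determines kind and index.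
-- (II) For each level i both paths must leave the levels ≤ i, by the direct edge
--   of level i or by the exit edge of some detour at level i. A rainbow path uses
--   each detour colour once, so if no direct edge is shared the 2P+1 levels are
--   tagged injectively by the detour types of either path: pigeonhole.
-- (I) A level whose direct colour is the j-th element of S takes a detour among
--   the k+1 types reserved for j; at most k of them meet S (pigeonhole again).

open import Defs
open import Data.Nat using (ℕ; zero; suc; _+_; _*_; _≤_; _<_; z≤n; z<s; s<s; _≟_; _≤?_)
import Data.Nat.Properties as ℕP
open import Data.Nat.DivMod using (_%_; [m+kn]%n≡m%n; m<n⇒m%n≡m)
open import Data.Fin using (Fin; zero; suc; toℕ; fromℕ; inject₁; combine; remQuot; join; splitAt)
import Data.Fin.Properties as FinP
open import Data.Maybe using (Maybe; just; nothing; Is-just)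
open import Data.Maybe.Properties using (just-injective)
import Data.Maybe.Relation.Unary.Any as MaybeAny
open import Data.List using (List; []; _∷_; _∷ʳ_; _++_; map; mapMaybe; length; lookup)
import Data.List.Properties as ListP
open import Data.List.Relation.Unary.All as All using (All; []; _∷_)
import Data.List.Relation.Unary.All.Properties as AllP
open import Data.List.Relation.Unary.Any as Any using (here; there)
open import Data.List.Relation.Unary.Any.Properties using (lookup-index)
open import Data.List.Relation.Unary.AllPairs using ([]; _∷_)
open import Data.List.Relation.Unary.Unique.Propositional using (Unique)
import Data.List.Relation.Unary.Unique.Propositional.Properties as UniqueP
open import Data.List.Membership.Propositional using (_∈_; _∉_)
open import Data.List.Membership.Propositional.Properties using (∈-map⁻)
open import Data.List.Membership.DecPropositional _≟_ using (_∈?_)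
open import Data.Product as Product using (_×_; _,_; ∃; ∃₂; ∃-syntax; proj₁; proj₂; uncurry)
open import Data.Sum as Sum using (_⊎_; inj₁; inj₂)
open import Data.Empty using (⊥-elim)
open import Data.Unit using (tt)
open import Function using (_∘_)
open import Relation.Nullary using (¬_; Dec; yes; no)
open import Relation.Unary using (Decidable)
open import Relation.Binary.PropositionalEquality

module _ {A B : Set} (g : A → Maybe B) where

  InjectiveOn : List A → Set
  InjectiveOn xs = ∀ {x y c} → x ∈ xs → y ∈ xs → g x ≡ just c → g y ≡ just c → x ≡ y

  ∈-mapMaybe⁺ : ∀ {x c} xs → x ∈ xs → g x ≡ just c → c ∈ mapMaybe g xs
  ∈-mapMaybe⁺ (y ∷ ys) (here refl) gx rewrite gx = here refl
  ∈-mapMaybe⁺ (y ∷ ys) (there x∈) gx with g y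
  ... | just _  = there (∈-mapMaybe⁺ ys x∈ gx)
  ... | nothing = ∈-mapMaybe⁺ ys x∈ gx

  ∈-mapMaybe⁻ : ∀ {c} xs → c ∈ mapMaybe g xs → ∃ λ x → x ∈ xs × g x ≡ just c
  ∈-mapMaybe⁻ (y ∷ ys) c∈ with g y in gy | c∈
  ... | just _  | here refl = y , here refl , gy
  ... | just _  | there c∈′ = Product.map₂ (Product.map₁ there) (∈-mapMaybe⁻ ys c∈′)
  ... | nothing | c∈′       = Product.map₂ (Product.map₁ there) (∈-mapMaybe⁻ ys c∈′)

  head-fresh : ∀ {x c} xs → Unique (mapMaybe g (x ∷ xs)) → g x ≡ just c → c ∉ mapMaybe g xs
  head-fresh {x} xs u gx with g x | gx | u
  ... | just _ | refl | fresh ∷ _ = λ c∈ → All.lookup fresh c∈ refl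

  unique-mapMaybe-tail : ∀ {x} xs → Unique (mapMaybe g (x ∷ xs)) → Unique (mapMaybe g xs)
  unique-mapMaybe-tail {x} xs u with g x | u
  ... | just _  | _ ∷ u′ = u′
  ... | nothing | u′     = u′

  Unique-mapMaybe⁻ : ∀ xs → Unique (mapMaybe g xs) → InjectiveOn xs
  Unique-mapMaybe⁻ (z ∷ zs) u (here refl) (here refl) gx gy = refl
  Unique-mapMaybe⁻ (z ∷ zs) u (here refl) (there y∈) gx gy =
    ⊥-elim (head-fresh zs u gx (∈-mapMaybe⁺ zs y∈ gy))
  Unique-mapMaybe⁻ (z ∷ zs) u (there x∈) (here refl) gx gy =
    ⊥-elim (head-fresh zs u gy (∈-mapMaybe⁺ zs x∈ gx))
  Unique-mapMaybe⁻ (z ∷ zs) u (there x∈) (there y∈) gx gy =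
    Unique-mapMaybe⁻ zs (unique-mapMaybe-tail zs u) x∈ y∈ gx gy

  Unique-mapMaybe⁺ : ∀ xs → Unique xs → InjectiveOn xs → Unique (mapMaybe g xs)
  Unique-mapMaybe⁺ []       _             _   = []
  Unique-mapMaybe⁺ (x ∷ xs) (x∉xs ∷ uxs) inj with g x in gx
  ... | nothing = Unique-mapMaybe⁺ xs uxs (λ p q → inj (there p) (there q))
  ... | just c  = All.tabulate fresh ∷ Unique-mapMaybe⁺ xs uxs (λ p q → inj (there p) (there q))
    where
      fresh : ∀ {d} → d ∈ mapMaybe g xs → c ≢ d
      fresh d∈ refl with ∈-mapMaybe⁻ xs d∈
      ... | y , y∈ , gy = All.lookup x∉xs y∈ (inj (here refl) (there y∈) gx gy)

Is-just⇒≡just : ∀ {A : Set} {m : Maybe A} → Is-just m → ∃ λ a → m ≡ just a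
Is-just⇒≡just (MaybeAny.just _) = _ , refl

∈-pairs⇒∈ : ∀ {A : Set} {a b : A} xs → (a , b) ∈ pairs xs → a ∈ xs
∈-pairs⇒∈ (x ∷ y ∷ xs) (here refl) = here refl
∈-pairs⇒∈ (x ∷ y ∷ xs) (there e∈)  = there (∈-pairs⇒∈ (y ∷ xs) e∈)

Unique-pairs : ∀ {A : Set} (xs : List A) → Unique xs → Unique (pairs xs)
Unique-pairs []           _          = []
Unique-pairs (x ∷ [])     _          = []
Unique-pairs (x ∷ y ∷ xs) (x∉ ∷ uxs) =
  All.tabulate (λ e∈ x≡ → All.lookup x∉ (∈-pairs⇒∈ (y ∷ xs) (subst (_∈ pairs (y ∷ xs)) (sym x≡) e∈)) refl)
  ∷ Unique-pairs (y ∷ xs) uxs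

pairs-map : ∀ {A B : Set} (h : A → B) xs → pairs (map h xs) ≡ map (Product.map h h) (pairs xs)
pairs-map h []           = refl
pairs-map h (x ∷ [])     = refl
pairs-map h (x ∷ y ∷ xs) = cong (_ ∷_) (pairs-map h (y ∷ xs))

leaving-edge : ∀ {A : Set} (Inside : A → Set) → Decidable Inside → ∀ x xs y → Inside x → ¬ Inside y →
  ∃₂ λ a b → (a , b) ∈ pairs (x ∷ (xs ∷ʳ y)) × Inside a × ¬ Inside b
leaving-edge Inside inside? x []       y x-in y-out = x , y , here refl , x-in , y-out
leaving-edge Inside inside? x (z ∷ zs) y x-in y-out with inside? z
... | yes z-in  = Product.map₂ (Product.map₂ (Product.map₁ there)) (leaving-edge Inside inside? z zs y z-in y-out)
... | no  z-out = x , z , here refl , x-in , z-out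

EdgesExist : ∀ {A : Set} → (A → A → Maybe ℕ) → List A → Set
EdgesExist c xs = All (λ e → Is-just (uncurry c e)) (pairs xs)

colourSeq : ∀ {A : Set} → (A → A → Maybe ℕ) → List A → List ℕ
colourSeq c xs = mapMaybe (uncurry c) (pairs xs)

-- a duplicate-free walk along existing edges, rainbow, avoiding the colours S;
-- on the vertex list of a path this unfolds to RainbowPath × Avoids
RainbowAvoiding : ∀ {A : Set} → (A → A → Maybe ℕ) → List ℕ → List A → Set
RainbowAvoiding c S xs = ((Unique xs × EdgesExist c xs) × Unique (colourSeq c xs)) × All (_∉ S) (colourSeq c xs)

module Relabel {A B : Set} (h : A → B) (cA : A → A → Maybe ℕ) (cB : B → B → Maybe ℕ)
               (preserves : ∀ a a′ → cB (h a) (h a′) ≡ cA a a′) where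

  colourSeq-map : ∀ xs → colourSeq cB (map h xs) ≡ colourSeq cA xs
  colourSeq-map xs = begin
    mapMaybe (uncurry cB) (pairs (map h xs))                 ≡⟨ cong (mapMaybe (uncurry cB)) (pairs-map h xs) ⟩
    mapMaybe (uncurry cB) (map (Product.map h h) (pairs xs)) ≡⟨ ListP.mapMaybe-map _ _ (pairs xs) ⟩
    mapMaybe (uncurry cB ∘ Product.map h h) (pairs xs)       ≡⟨ ListP.mapMaybe-cong (λ (a , a′) → preserves a a′) (pairs xs) ⟩
    mapMaybe (uncurry cA) (pairs xs)                         ∎
    where open ≡-Reasoning

  EdgesExist-map : ∀ xs → EdgesExist cA xs → EdgesExist cB (map h xs)
  EdgesExist-map xs edges rewrite pairs-map h xs =
    AllP.map⁺ (All.map (λ {(a , a′)} → subst Is-just (sym (preserves a a′))) edges)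

  RainbowAvoiding-map : (∀ {a a′} → h a ≡ h a′ → a ≡ a′) → ∀ S xs →
    RainbowAvoiding cA S xs → RainbowAvoiding cB S (map h xs)
  RainbowAvoiding-map h-inj S xs (((uxs , edges) , rainbow) , avoids)
    rewrite colourSeq-map xs = ((UniqueP.map⁺ h-inj uxs , EdgesExist-map xs edges) , rainbow) , avoids

some-or-all : ∀ {n} {A B : Fin n → Set} → ((i : Fin n) → A i ⊎ B i) → ∃ A ⊎ ((i : Fin n) → B i)
some-or-all {zero}  choice = inj₂ λ ()
some-or-all {suc n} choice with choice zero | some-or-all (choice ∘ suc)
... | inj₁ a | _              = inj₁ (zero , a)
... | inj₂ _ | inj₁ (i , a)   = inj₁ (suc i , a)
... | inj₂ b | inj₂ bs        = inj₂ (FinP.∀-cons b bs)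

no-injection-into-⊎ : ∀ n (g : Fin (suc (n + n)) → Fin n ⊎ Fin n) → ¬ (∀ i j → g i ≡ g j → i ≡ j)
no-injection-into-⊎ n g g-inj with FinP.pigeonhole (ℕP.n<1+n (n + n)) (join n n ∘ g)
... | i , j , i<j , same = ℕP.<-irrefl (cong toℕ (g-inj i j g≡)) i<j
  where
    g≡ : g i ≡ g j
    g≡ = trans (sym (FinP.splitAt-join n n (g i))) (trans (cong (splitAt n) same) (FinP.splitAt-join n n (g j)))

free-candidate : ∀ {n} (Blocked : Fin (suc n) → Set) → Decidable Blocked →
  (witness : ∀ {x} → Blocked x → Fin n) →
  (∀ {x y} (p : Blocked x) (q : Blocked y) → witness p ≡ witness q → x ≡ y) →
  ∃ λ x → ¬ Blocked x
free-candidate {n} Blocked blocked? witness witness-inj =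
  FinP.¬∀⟶∃¬ (suc n) Blocked blocked? all-blocked
  where
    all-blocked : ¬ (∀ x → Blocked x)
    all-blocked blocked with FinP.pigeonhole (ℕP.n<1+n n) (λ x → witness (blocked x))
    ... | x , y , x<y , same = ℕP.<-irrefl (cong toℕ (witness-inj (blocked x) (blocked y) same)) x<y

data Kind : Set where
  direct entry exit : Kind

residue : Kind → ℕ
residue direct = 0
residue entry  = 1
residue exit   = 2

kindOf : ℕ → Kind
kindOf 0 = direct
kindOf 1 = entry
kindOf _ = exit

kindOf-residue : ∀ κ → kindOf (residue κ) ≡ κ
kindOf-residue direct = refl
kindOf-residue entry  = refl
kindOf-residue exit   = refl

residue<3 : ∀ κ → residue κ < 3
residue<3 direct = z<s
residue<3 entry  = s<s z<s
residue<3 exit   = s<s (s<s z<s)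

colour : Kind → ℕ → ℕ
colour κ a = residue κ + a * 3

colour%3 : ∀ κ a → colour κ a % 3 ≡ residue κ
colour%3 κ a = trans ([m+kn]%n≡m%n (residue κ) a 3) (m<n⇒m%n≡m (residue<3 κ))

colour-kind : ∀ {κ κ′ a a′} → colour κ a ≡ colour κ′ a′ → κ ≡ κ′
colour-kind {κ} {κ′} {a} {a′} same = begin
  κ                          ≡⟨ sym (kindOf-residue κ) ⟩
  kindOf (residue κ)         ≡⟨ cong kindOf (sym (colour%3 κ a)) ⟩
  kindOf (colour κ a % 3)    ≡⟨ cong (kindOf ∘ (_% 3)) same ⟩
  kindOf (colour κ′ a′ % 3)  ≡⟨ cong kindOf (colour%3 κ′ a′) ⟩
  kindOf (residue κ′)        ≡⟨ kindOf-residue κ′ ⟩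
  κ′                         ∎
  where open ≡-Reasoning

colour-injective : ∀ {κ κ′ a a′} → colour κ a ≡ colour κ′ a′ → κ ≡ κ′ × a ≡ a′
colour-injective {κ} {κ′} {a} {a′} same with colour-kind {κ} {κ′} {a} {a′} same
... | refl = refl , ℕP.*-cancelʳ-≡ a a′ 3 (ℕP.+-cancelˡ-≡ (residue κ) _ _ same)

-- The spine vertex (p , zero)
-- of level p is joined to (p+1 , zero) by a direct edge of colour (direct , p);
-- the detour vertex (p , suc t) is entered from (p , zero) by colour (entry , t)
-- and left towards (p+1 , zero) by colour (exit , t). Detour colours do not
-- depend on the level, so a rainbow path uses each detour type at most once.

module Graph (P : ℕ) where

  W : ℕ → Set
  W m = Fin (suc m) × Fin (suc P)

  edgeIf : ∀ {A : Set} → Dec A → ℕ → Maybe ℕ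
  edgeIf (yes _) c = just c
  edgeIf (no _)  _ = nothing

  edgeIf-just : ∀ {A : Set} (d : Dec A) {c c′} → edgeIf d c ≡ just c′ → A × c ≡ c′
  edgeIf-just (yes a) refl = a , refl

  edgeIf-yes : ∀ {A : Set} (d : Dec A) {c} → A → edgeIf d c ≡ just c
  edgeIf-yes (yes _) _ = refl
  edgeIf-yes (no ¬a) a = ⊥-elim (¬a a)

  colW : ∀ {m} → W m → W m → Maybe ℕ
  colW (p , zero)  (q , zero)  = edgeIf (toℕ q ≟ suc (toℕ p)) (colour direct (toℕ p))
  colW (p , zero)  (q , suc t) = edgeIf (toℕ q ≟ toℕ p)       (colour entry  (toℕ t))
  colW (p , suc t) (q , zero)  = edgeIf (toℕ q ≟ suc (toℕ p)) (colour exit   (toℕ t))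
  colW (p , suc _) (q , suc _) = nothing

  -- Routes. A choice f : Fin m → Maybe (Fin P) says, for each level, whether
  -- to step directly or through a detour; route f is the resulting walk.

  up : ∀ {m} → W m → W (suc m)
  up (p , r) = suc p , r

  detourAtBase : ∀ {m} → Maybe (Fin P) → List (W (suc m))
  detourAtBase nothing  = []
  detourAtBase (just t) = (zero , suc t) ∷ []

  route routeTail : ∀ {m} → (Fin m → Maybe (Fin P)) → List (W m)
  route f = (zero , zero) ∷ routeTail f
  routeTail {zero}  f = []
  routeTail {suc m} f = detourAtBase (f zero) ++ map up (route (f ∘ suc))

  route-ends : ∀ {m} (f : Fin (suc m) → Maybe (Fin P)) →
    ∃ λ mid → route f ≡ (zero , zero) ∷ (mid ∷ʳ (fromℕ (suc m) , zero))
  route-ends {zero}  f = detourAtBase (f zero) , refl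
  route-ends {suc m} f with route-ends (f ∘ suc)
  ... | mid , eq = detourAtBase (f zero) ++ (up (zero , zero) ∷ map up mid) , cong ((zero , zero) ∷_) (begin
      routeTail f
        ≡⟨ cong (λ r → detourAtBase (f zero) ++ map up r) eq ⟩
      detourAtBase (f zero) ++ (up (zero , zero) ∷ map up (mid ∷ʳ _))
        ≡⟨ cong (λ r → detourAtBase (f zero) ++ (up (zero , zero) ∷ r)) (ListP.map-++ up mid _) ⟩
      detourAtBase (f zero) ++ ((up (zero , zero) ∷ map up mid) ∷ʳ _)
        ≡⟨ sym (ListP.++-assoc (detourAtBase (f zero)) _ _) ⟩
      (detourAtBase (f zero) ++ (up (zero , zero) ∷ map up mid)) ∷ʳ _ ∎)
    where open ≡-Reasoning

  up-injective : ∀ {m} {w w′ : W m} → up w ≡ up w′ → w ≡ w′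
  up-injective refl = refl

  base-fresh : ∀ {m r} (ws : List (W m)) → All ((zero , r) ≢_) (map up ws)
  base-fresh ws = AllP.map⁺ (All.tabulate (λ _ → λ ()))

  route-unique : ∀ {m} (f : Fin m → Maybe (Fin P)) → Unique (route f)
  route-unique {zero}  f = [] ∷ []
  route-unique {suc m} f with f zero
  ... | nothing = base-fresh _ ∷ UniqueP.map⁺ up-injective (route-unique (f ∘ suc))
  ... | just t  = ((λ ()) ∷ base-fresh _) ∷ base-fresh _ ∷ UniqueP.map⁺ up-injective (route-unique (f ∘ suc))

  data RouteEdge {m} (f : Fin m → Maybe (Fin P)) : Kind → W m × W m → Set where
    directE : ∀ i → f i ≡ nothing → RouteEdge f direct ((inject₁ i , zero) , (suc i , zero))
    entryE  : ∀ i {t} → f i ≡ just t → RouteEdge f entry ((inject₁ i , zero) , (inject₁ i , suc t))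
    exitE   : ∀ i {t} → f i ≡ just t → RouteEdge f exit ((inject₁ i , suc t) , (suc i , zero))

  index : ∀ {m f κ e} → RouteEdge {m} f κ e → ℕ
  index (directE i _)    = toℕ i
  index (entryE _ {t} _) = toℕ t
  index (exitE _ {t} _)  = toℕ t

  shift-edge : ∀ {m} {f : Fin (suc m) → Maybe (Fin P)} {κ e} →
    RouteEdge (f ∘ suc) κ e → RouteEdge f κ (Product.map up up e)
  shift-edge (directE i eq) = directE (suc i) eq
  shift-edge (entryE i eq)  = entryE (suc i) eq
  shift-edge (exitE i eq)   = exitE (suc i) eq

  route-edge : ∀ {m} (f : Fin m → Maybe (Fin P)) {e} → e ∈ pairs (route f) → ∃ λ κ → RouteEdge f κ e
  route-edge-up : ∀ {m} (f : Fin (suc m) → Maybe (Fin P)) {e} →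
    e ∈ pairs (map up (route (f ∘ suc))) → ∃ λ κ → RouteEdge f κ e

  route-edge {suc m} f e∈ with f zero in eq | e∈
  ... | nothing | here refl         = direct , directE zero eq
  ... | nothing | there e∈′         = route-edge-up f e∈′
  ... | just t  | here refl         = entry , entryE zero eq
  ... | just t  | there (here refl) = exit , exitE zero eq
  ... | just t  | there (there e∈′) = route-edge-up f e∈′

  route-edge-up f e∈ rewrite pairs-map up (route (f ∘ suc)) with ∈-map⁻ _ e∈
  ... | _ , e′∈ , refl = Product.map₂ shift-edge (route-edge (f ∘ suc) e′∈)

  routeEdge-colour : ∀ {m f κ e} (φ : RouteEdge {m} f κ e) → uncurry colW e ≡ just (colour κ (index φ))
  routeEdge-colour (directE i _) rewrite FinP.toℕ-inject₁ i = edgeIf-yes _ refl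
  routeEdge-colour (entryE i _)  = edgeIf-yes _ refl
  routeEdge-colour (exitE i _)   rewrite FinP.toℕ-inject₁ i = edgeIf-yes _ refl

  route-edges-exist : ∀ {m} (f : Fin m → Maybe (Fin P)) → EdgesExist colW (route f)
  route-edges-exist f = All.tabulate λ e∈ →
    subst Is-just (sym (routeEdge-colour (proj₂ (route-edge f e∈)))) (MaybeAny.just tt)

  DetourInjective : ∀ {m} → (Fin m → Maybe (Fin P)) → Set
  DetourInjective f = ∀ {i i′ t} → f i ≡ just t → f i′ ≡ just t → i ≡ i′

  routeEdge-determined : ∀ {m} {f : Fin m → Maybe (Fin P)} → DetourInjective f →
    ∀ {κ e e′} (φ : RouteEdge f κ e) (ψ : RouteEdge f κ e′) → index φ ≡ index ψ → e ≡ e′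
  routeEdge-determined _ (directE i _) (directE i′ _) same with FinP.toℕ-injective {i = i} {j = i′} same
  ... | refl = refl
  routeEdge-determined inj (entryE i fi) (entryE i′ fi′) same with FinP.toℕ-injective same
  ... | refl with inj fi fi′
  ...   | refl = refl
  routeEdge-determined inj (exitE i fi) (exitE i′ fi′) same with FinP.toℕ-injective same
  ... | refl with inj fi fi′
  ...   | refl = refl

  routeEdge-colour-injective : ∀ {m} {f : Fin m → Maybe (Fin P)} → DetourInjective f →
    ∀ {κ κ′ e e′} (φ : RouteEdge f κ e) (ψ : RouteEdge f κ′ e′) → uncurry colW e ≡ uncurry colW e′ → e ≡ e′
  routeEdge-colour-injective inj {κ} {κ′} φ ψ same
    with colour-injective {κ} {κ′} {index φ} {index ψ}
           (just-injective (trans (sym (routeEdge-colour φ)) (trans same (routeEdge-colour ψ))))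
  ... | refl , same-index = routeEdge-determined inj φ ψ same-index

  route-rainbow : ∀ {m} (f : Fin m → Maybe (Fin P)) → DetourInjective f → Unique (colourSeq colW (route f))
  route-rainbow f inj = Unique-mapMaybe⁺ (uncurry colW) _ (Unique-pairs _ (route-unique f)) same-colour
    where
      same-colour : InjectiveOn (uncurry colW) (pairs (route f))
      same-colour e∈ e′∈ ce ce′ =
        routeEdge-colour-injective inj (proj₂ (route-edge f e∈)) (proj₂ (route-edge f e′∈)) (trans ce (sym ce′))

  route-avoids : ∀ {m} (f : Fin m → Maybe (Fin P)) (S : List ℕ) →
    (∀ {κ e} (φ : RouteEdge f κ e) → colour κ (index φ) ∉ S) → All (_∉ S) (colourSeq colW (route f))
  route-avoids f S fresh = All.tabulate λ c∈ → edge-colour-fresh (∈-mapMaybe⁻ (uncurry colW) _ c∈)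
    where
      edge-colour-fresh : ∀ {c} → (∃ λ e → e ∈ pairs (route f) × uncurry colW e ≡ just c) → c ∉ S
      edge-colour-fresh (e , e∈ , ce) with route-edge f e∈
      ... | κ , φ = subst (_∉ S) (just-injective (trans (sym (routeEdge-colour φ)) ce)) (fresh φ)

  -- Levels. Every edge stays on its level or climbs exactly one level.

  level : ∀ {m} → W m → ℕ
  level = toℕ ∘ proj₁

  climbs-from : ∀ {p q I} → p ≤ I → q ≡ suc p → ¬ q ≤ I → p ≡ I
  climbs-from low refl high = ℕP.≤-antisym low (ℕP.≮⇒≥ high)

  leaving-classified : ∀ {m} (i : Fin m) {w w′ : W m} {c} → colW w w′ ≡ just c →
    level w ≤ toℕ i → ¬ level w′ ≤ toℕ i →
    (w , w′) ≡ ((inject₁ i , zero) , (suc i , zero))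
    ⊎ ∃ λ (t : Fin P) → colW w w′ ≡ just (colour exit (toℕ t)) × level w ≡ toℕ i
  leaving-classified i {p , zero} {q , zero} ce low high with edgeIf-just (toℕ q ≟ suc (toℕ p)) ce
  ... | q≡ , _ = inj₁ (cong₂ _,_ (cong (_, zero) p≡) (cong (_, zero) (FinP.toℕ-injective (trans q≡ (cong suc p≡i)))))
    where
      p≡i : toℕ p ≡ toℕ i
      p≡i = climbs-from low q≡ high
      p≡ : p ≡ inject₁ i
      p≡ = FinP.toℕ-injective (trans p≡i (sym (FinP.toℕ-inject₁ i)))
  leaving-classified i {p , zero} {q , suc t} ce low high with edgeIf-just (toℕ q ≟ toℕ p) ce
  ... | q≡ , _ = ⊥-elim (high (subst (_≤ toℕ i) (sym q≡) low))
  leaving-classified i {p , suc t} {q , zero} ce low high with edgeIf-just (toℕ q ≟ suc (toℕ p)) ce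
  ... | q≡ , c≡ = inj₂ (t , trans ce (cong just (sym c≡)) , climbs-from low q≡ high)
  leaving-classified i {_ , suc _} {_ , suc _} () _ _

  M N : ℕ
  M = suc (P + P)
  N = suc M * suc P

  enc : W M → Fin N
  enc = uncurry combine

  dec : Fin N → W M
  dec = remQuot (suc P)

  dec-enc : ∀ w → dec (enc w) ≡ w
  dec-enc (p , r) = FinP.remQuot-combine p r

  enc-dec : ∀ x → enc (dec x) ≡ x
  enc-dec = FinP.combine-remQuot (suc P)

  enc-injective : ∀ {w w′} → enc w ≡ enc w′ → w ≡ w′
  enc-injective {w} {w′} eq = trans (sym (dec-enc w)) (trans (cong dec eq) (dec-enc w′))

  D : ColouredDigraph
  D = record { n = N ; col = λ x y → colW (dec x) (dec y) }

  u v : Fin N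
  u = enc (zero , zero)
  v = enc (fromℕ M , zero)

  u≢v : u ≢ v
  u≢v eq with enc-injective {zero , zero} {fromℕ M , zero} eq
  ... | ()

  col-enc : ∀ w w′ → col D (enc w) (enc w′) ≡ colW w w′
  col-enc w w′ = cong₂ colW (dec-enc w) (dec-enc w′)

  route-path : (f : Fin M → Maybe (Fin P)) (S : List ℕ) → DetourInjective f →
    (∀ {κ e} (φ : RouteEdge f κ e) → colour κ (index φ) ∉ S) →
    ∃[ mid ] (RainbowPath D u mid v × Avoids D S u mid v)
  route-path f S inj fresh with route-ends f
  ... | mid , ends = map enc mid , subst (RainbowAvoiding (col D) S) enc-ends in-D
    where
      in-D : RainbowAvoiding (col D) S (map enc (route f))
      in-D = Relabel.RainbowAvoiding-map enc colW (col D) col-enc enc-injective S (route f)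
               (((route-unique f , route-edges-exist f) , route-rainbow f inj) , route-avoids f S fresh)

      enc-ends : map enc (route f) ≡ u ∷ (map enc mid ∷ʳ v)
      enc-ends = trans (cong (map enc) ends) (cong (u ∷_) (ListP.map-++ enc mid _))

  SpineStep : List (Fin N) → Fin M → Set
  SpineStep xs i = (enc (inject₁ i , zero) , enc (suc i , zero)) ∈ pairs xs

  ExitAt : List (Fin N) → Fin M → Fin P → Set
  ExitAt xs i t = ∃ λ e → e ∈ pairs xs × uncurry (col D) e ≡ just (colour exit (toℕ t))
                                       × level (dec (proj₁ e)) ≡ toℕ i

  Below : Fin M → Fin N → Set
  Below i x = level (dec x) ≤ toℕ i

  u-below : ∀ i → Below i u
  u-below i rewrite dec-enc (zero , zero) = z≤n

  v-above : ∀ i → ¬ Below i v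
  v-above i v-low = ℕP.<-irrefl refl (ℕP.<-≤-trans (FinP.toℕ<n i) M≤i)
    where
      M≤i : M ≤ toℕ i
      M≤i = subst (_≤ toℕ i) (FinP.toℕ-fromℕ M) (subst (λ w → level w ≤ toℕ i) (dec-enc (fromℕ M , zero)) v-low)

  leaves-level : ∀ mid → IsPath D u mid v → (i : Fin M) →
    SpineStep (verts D u mid v) i ⊎ ∃ (ExitAt (verts D u mid v) i)
  leaves-level mid (_ , edges) i
    with leaving-edge (Below i) (λ x → level (dec x) ≤? toℕ i) u mid v (u-below i) (v-above i)
  ... | a , b , ab∈ , a-low , b-high with Is-just⇒≡just (All.lookup edges ab∈)
  ... | c , ce with leaving-classified i ce a-low b-high
  ... | inj₁ same            = inj₁ (subst (_∈ pairs (verts D u mid v)) ab≡ ab∈)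
    where
      ab≡ : (a , b) ≡ (enc (inject₁ i , zero) , enc (suc i , zero))
      ab≡ = trans (sym (cong₂ _,_ (enc-dec a) (enc-dec b))) (cong (Product.map enc enc) same)
  ... | inj₂ (t , ce′ , lvl) = inj₂ (t , (a , b) , ab∈ , ce′ , lvl)

  exit-level-unique : ∀ mid → Rainbow D u mid v → ∀ {i j t} →
    ExitAt (verts D u mid v) i t → ExitAt (verts D u mid v) j t → i ≡ j
  exit-level-unique mid rainbow (e , e∈ , ce , lvl) (e′ , e′∈ , ce′ , lvl′)
    with Unique-mapMaybe⁻ (uncurry (col D)) (edges D u mid v) rainbow e∈ e′∈ ce ce′
  ... | refl = FinP.toℕ-injective (trans (sym lvl) lvl′)

  -- if neither path takes the direct edge of level i, each leaves level i via
  -- a detour; this tags the 2P+1 levels injectively by detour types of P₁ or P₂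
  two-rainbow-paths-meet : ∀ P₁ P₂ → RainbowPath D u P₁ v → RainbowPath D u P₂ v → CommonEdge D u P₁ P₂ v
  two-rainbow-paths-meet P₁ P₂ (path₁ , rainbow₁) (path₂ , rainbow₂) = meet (some-or-all per-level)
    where
      Exits : Fin M → Set
      Exits i = ∃ (ExitAt (verts D u P₁ v) i) ⊎ ∃ (ExitAt (verts D u P₂ v) i)

      per-level : (i : Fin M) → (SpineStep (verts D u P₁ v) i × SpineStep (verts D u P₂ v) i) ⊎ Exits i
      per-level i with leaves-level P₁ path₁ i | leaves-level P₂ path₂ i
      ... | inj₁ spine₁ | inj₁ spine₂ = inj₁ (spine₁ , spine₂)
      ... | inj₂ exit₁  | _           = inj₂ (inj₁ exit₁)
      ... | inj₁ _      | inj₂ exit₂  = inj₂ (inj₂ exit₂)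

      tag : ∀ {i} → Exits i → Fin P ⊎ Fin P
      tag = Sum.map proj₁ proj₁

      tag-injective : ∀ {i j} (x : Exits i) (y : Exits j) → tag x ≡ tag y → i ≡ j
      tag-injective (inj₁ (t , x)) (inj₁ (.t , y)) refl = exit-level-unique P₁ rainbow₁ {t = t} x y
      tag-injective (inj₂ (t , x)) (inj₂ (.t , y)) refl = exit-level-unique P₂ rainbow₂ {t = t} x y
      tag-injective (inj₁ _) (inj₂ _) ()
      tag-injective (inj₂ _) (inj₁ _) ()

      meet : (∃ λ i → SpineStep (verts D u P₁ v) i × SpineStep (verts D u P₂ v) i) ⊎ ((i : Fin M) → Exits i) →
             CommonEdge D u P₁ P₂ v
      meet (inj₁ (_ , spine₁ , spine₂)) = _ , spine₁ , spine₂
      meet (inj₂ exits) = ⊥-elim (no-injection-into-⊎ P (tag ∘ exits) (λ i j → tag-injective (exits i) (exits j)))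

-- Choosing the route for a colour set S of size k, in the graph with
-- P = k(k+1) detour types: the detour types combine j x (x ≤ k) are reserved
-- for the j-th element of S.

module Avoiding (S : List ℕ) where

  k P : ℕ
  k = length S
  P = k * suc k

  open Graph P

  data Blocked (a : ℕ) : Set where
    entry-blocked : colour entry a ∈ S → Blocked a
    exit-blocked  : colour exit a ∈ S → Blocked a

  blocked? : Decidable Blocked
  blocked? a with colour entry a ∈? S | colour exit a ∈? S
  ... | yes c∈ | _      = yes (entry-blocked c∈)
  ... | no _   | yes c∈ = yes (exit-blocked c∈)
  ... | no c∉  | no c′∉ = no λ { (entry-blocked c∈) → c∉ c∈ ; (exit-blocked c∈) → c′∉ c∈ }

  blocker : ∀ {a} → Blocked a → Fin k
  blocker (entry-blocked c∈) = Any.index c∈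
  blocker (exit-blocked c∈)  = Any.index c∈

  blocker-colour : ∀ {a} (b : Blocked a) → ∃ λ κ → lookup S (blocker b) ≡ colour κ a
  blocker-colour (entry-blocked c∈) = entry , sym (lookup-index c∈)
  blocker-colour (exit-blocked c∈)  = exit  , sym (lookup-index c∈)

  blocker-injective : ∀ {a a′} (b : Blocked a) (b′ : Blocked a′) → blocker b ≡ blocker b′ → a ≡ a′
  blocker-injective {a} {a′} b b′ same with blocker-colour b | blocker-colour b′
  ... | κ , c | κ′ , c′ = proj₂ (colour-injective {κ} {κ′} {a} {a′} (trans (sym c) (trans (cong (lookup S) same) c′)))

  -- among the k+1 detour types reserved for position j at most k are blocked
  free-slot : (j : Fin k) → ∃ λ x → ¬ Blocked (toℕ (combine j x))
  free-slot j = free-candidate (Blocked ∘ toℕ ∘ combine j) (blocked? ∘ toℕ ∘ combine j) blocker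
    (λ b b′ same → FinP.combine-injectiveʳ j _ j _ (FinP.toℕ-injective (blocker-injective b b′ same)))

  detourFor : Fin k → Fin P
  detourFor j = combine j (proj₁ (free-slot j))

  detourFor-injective : ∀ {j j′} → detourFor j ≡ detourFor j′ → j ≡ j′
  detourFor-injective {j} {j′} = FinP.combine-injectiveˡ j (proj₁ (free-slot j)) j′ (proj₁ (free-slot j′))

  choose : ∀ {c} → Dec (c ∈ S) → Maybe (Fin P)
  choose (yes c∈) = just (detourFor (Any.index c∈))
  choose (no _)   = nothing

  choice : Fin M → Maybe (Fin P)
  choice i = choose (colour direct (toℕ i) ∈? S)

  choose-nothing : ∀ {c} (d : Dec (c ∈ S)) → choose d ≡ nothing → c ∉ S
  choose-nothing (no c∉) _ = c∉
  choose-nothing (yes _) ()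

  choose-just : ∀ {c t} (d : Dec (c ∈ S)) → choose d ≡ just t → ∃ λ j → t ≡ detourFor j × lookup S j ≡ c
  choose-just (yes c∈) refl = Any.index c∈ , refl , sym (lookup-index c∈)
  choose-just (no _)   ()

  Owner : Fin M → Fin P → Set
  Owner i t = ∃ λ j → t ≡ detourFor j × lookup S j ≡ colour direct (toℕ i)

  choice-owner : ∀ i {t} → choice i ≡ just t → Owner i t
  choice-owner i = choose-just (colour direct (toℕ i) ∈? S)

  owner-level : ∀ {i i′ t} → Owner i t → Owner i′ t → i ≡ i′
  owner-level {i} {i′} (j , t≡ , c) (j′ , t≡′ , c′) =
    FinP.toℕ-injective (proj₂ (colour-injective {direct} {direct} {toℕ i} {toℕ i′} (begin
      colour direct (toℕ i)   ≡⟨ sym c ⟩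
      lookup S j              ≡⟨ cong (lookup S) (detourFor-injective (trans (sym t≡) t≡′)) ⟩
      lookup S j′             ≡⟨ c′ ⟩
      colour direct (toℕ i′)  ∎)))
    where open ≡-Reasoning

  owner-free : ∀ {i t} → Owner i t → ¬ Blocked (toℕ t)
  owner-free (j , refl , _) = proj₂ (free-slot j)

  choice-injective : DetourInjective choice
  choice-injective {i} {i′} fi fi′ = owner-level (choice-owner i fi) (choice-owner i′ fi′)

  choice-fresh : ∀ {κ e} (φ : RouteEdge choice κ e) → colour κ (index φ) ∉ S
  choice-fresh (directE i fi) = choose-nothing (colour direct (toℕ i) ∈? S) fi
  choice-fresh (entryE i fi)  = owner-free {i} (choice-owner i fi) ∘ entry-blocked
  choice-fresh (exitE i fi)   = owner-free {i} (choice-owner i fi) ∘ exit-blocked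

-- (I) for every colour set of size k; duplicates in S would only help, so
-- S need not be duplicate-free
avoiding-path : ∀ k (S : List ℕ) → length S ≡ k →
  let open Graph (k * suc k) in ∃[ mid ] (RainbowPath D u mid v × Avoids D S u mid v)
avoiding-path .(length S) S refl = Graph.route-path P choice S choice-injective choice-fresh
  where open Avoiding S

proposition5p2 : (k : ℕ) →
    ∃[ D ] ∃[ u ] ∃[ v ]
      ( u ≢ v
      × ((S : List ℕ) → Unique S → length S ≡ k →
           ∃[ P ] (RainbowPath D u P v × Avoids D S u P v))
      × ((P₁ P₂ : List (V D)) → RainbowPath D u P₁ v → RainbowPath D u P₂ v →
           CommonEdge D u P₁ P₂ v) )
proposition5p2 k = D , u , v , u≢v , (λ S _ → avoiding-path k S) , two-rainbow-paths-meet
  where open Graph (k * suc k)
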